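{- Let $\mathsf{G}$ be a complete convex geometric graph of even order $n$. Let $f$ be an almost-halving edge, $e$ a halving edge, and $E$ a halving pair of $\mathsf{G}$. Then (i) $f$ and $e$ intersect, and (ii) $f$ and $E$ intersect.
   Context: A complete convex geometric graph of order $n$ is the complete geometric graph (all straight-line segments) on $n$ points in convex position; its vertices are labeled $1,\dots,n$ in clockwise order and all index arithmetic is modulo $n$. $e_{i,j}$ denotes the edge between vertices $i$ and $j$. Two edges intersect if they share an endpoint or cross. An edge $e_{i,j}$ is a halving edge if each of the two open half-planes bounded by the line through $e_{i,j}$ contains at least $\lfloor \frac{n-2}{2}\rfloor$ vertices. For $n$ even, $e_{i,j}$ is an almost-halving edge if $e_{i,j+1}$ is a halving edge. For $i,j,k\in\{1,\dots,n\}$ such that $e_{i,j}$ and $e_{j+1,k}$ do not intersect, $(e_{i,j},e_{j+1,k})$ is a halving pair if at least one of $e_{i,j+1}$, $e_{i,k}$, $e_{j,k}$ is a halving edge. An edge intersects a pair of edges if it intersects at least one edge of the pair. -}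

module Defs where

open import Data.Nat using (ℕ; zero; suc; _+_; _∸_; _<_; _≤_; NonZero)
open import Data.Nat.DivMod using (_%_; _/_; m%n<n)
open import Data.Fin using (Fin; toℕ; fromℕ<)
open import Data.Product using (_×_)
open import Data.Sum using (_⊎_)
open import Relation.Nullary using (¬_)
open import Relation.Binary.PropositionalEquality using (_≡_; _≢_)

-- Vertices of the complete convex geometric graph of order n are Fin n
-- (label k+1 of the paper is Fin element k), in clockwise order.

module _ {n : ℕ} {{_ : NonZero n}} where

  next : Fin n → Fin n
  next j = fromℕ< (m%n<n (suc (toℕ j)) n)

  cw : Fin n → Fin n → ℕ
  cw a b = (toℕ b + (n ∸ toℕ a)) % n

  Between : Fin n → Fin n → Fin n → Set
  Between a b x = (0 < cw a x) × (cw a x < cw a b)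

  -- e_{a,b} is a halving edge: it is an edge (a ≠ b) and both open
  -- half-planes bounded by its line contain ≥ ⌊(n-2)/2⌋ vertices; the
  -- vertices on the two sides are those strictly inside the clockwise
  -- arcs a→b (cw a b - 1 of them) and b→a (cw b a - 1 of them).
  Halving : Fin n → Fin n → Set
  Halving a b = (a ≢ b) × ((n ∸ 2) / 2 ≤ cw a b ∸ 1) × ((n ∸ 2) / 2 ≤ cw b a ∸ 1)

  AlmostHalving : Fin n → Fin n → Set
  AlmostHalving a b = (a ≢ b) × (Halving a (next b) ⊎ Halving b (next a))

  Cross : Fin n → Fin n → Fin n → Fin n → Set
  Cross a b c d = (Between a b c × ¬ Between a b d) ⊎ (¬ Between a b c × Between a b d)

  Intersect : Fin n → Fin n → Fin n → Fin n → Set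
  Intersect a b c d = (a ≡ c) ⊎ (a ≡ d) ⊎ (b ≡ c) ⊎ (b ≡ d) ⊎ Cross a b c d

  HalvingPair : Fin n → Fin n → Fin n → Set
  HalvingPair i j k =
    (i ≢ j) × (next j ≢ k) × ¬ Intersect i j (next j) k ×
    (Halving i (next j) ⊎ Halving i k ⊎ Halving j k)

-- For n = 2q the halving edges are exactly the antipodal pairs (cw x y = q), and an
-- almost-halving edge e_{a,b} has cw a b = q - 1 in one of its two orientations. Seen
-- from a, the positions of two antipodes differ by q, so exactly one of them lies
-- strictly inside the arc from a to b: the two edges cross unless they share an endpoint.
-- If e_{a,b} missed both edges of a halving pair, the vertices i, j, j+1, k would all
-- lie strictly on one side of it (j and j+1 being adjacent), and so would the halving
-- edge among them, contradicting (i).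

module Submission where

open import Data.Nat
open import Data.Nat.Properties
open import Data.Nat.DivMod
open import Data.Nat.Divisibility using (_∣_; divides)
open import Algebra.Properties.CommutativeSemigroup +-commutativeSemigroup using (x∙yz≈y∙xz)
open import Data.Nat.Solver using (module +-*-Solver)
open import Data.Fin using (Fin; toℕ) renaming (_≟_ to _≟ᶠ_)
open import Data.Fin.Properties using (toℕ-fromℕ<; toℕ-injective; toℕ<n)
open import Data.Product using (_×_; _,_; swap)
open import Data.Sum using (_⊎_; inj₁; inj₂)
open import Data.Empty using (⊥; ⊥-elim)
open import Function.Base using (_∘_)
open import Function.Bundles using (_⇔_; mk⇔; Equivalence)
import Function.Properties.Equivalence as ⇔
open import Relation.Nullary
open import Relation.Binary.PropositionalEquality
open import Defs

open +-*-Solver using (solve; _:+_; _:=_)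

[m+n%o]%o≡[m+n]%o : ∀ m n o .{{_ : NonZero o}} → (m + n % o) % o ≡ (m + n) % o
[m+n%o]%o≡[m+n]%o m n o = begin
  (m + n % o) % o          ≡⟨ %-distribˡ-+ m (n % o) o ⟩
  (m % o + n % o % o) % o  ≡⟨ cong (λ t → (m % o + t) % o) (m%n%n≡m%n n o) ⟩
  (m % o + n % o) % o      ≡⟨ %-distribˡ-+ m n o ⟨
  (m + n) % o              ∎
  where open ≡-Reasoning

[m%o+n]%o≡[m+n]%o : ∀ m n o .{{_ : NonZero o}} → (m % o + n) % o ≡ (m + n) % o
[m%o+n]%o≡[m+n]%o m n o = begin
  (m % o + n) % o          ≡⟨ %-distribˡ-+ (m % o) n o ⟩
  (m % o % o + n % o) % o  ≡⟨ cong (λ t → (t + n % o) % o) (m%n%n≡m%n m o) ⟩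
  (m % o + n % o) % o      ≡⟨ %-distribˡ-+ m n o ⟨
  (m + n) % o              ∎
  where open ≡-Reasoning

m<n+n⇒m≡m%n⊎m≡m%n+n : ∀ m n .{{_ : NonZero n}} → m < n + n → m ≡ m % n ⊎ m ≡ m % n + n
m<n+n⇒m≡m%n⊎m≡m%n+n m n m<n+n
  with m / n | m≡m%n+[m/n]*n m n
     | m<n*o⇒m/o<n {m} {2} {n} (subst (m <_) (cong (n +_) (sym (+-identityʳ n))) m<n+n)
... | 0           | m≡ | _ = inj₁ (trans m≡ (+-identityʳ (m % n)))
... | 1           | m≡ | _ = inj₂ (trans m≡ (cong (m % n +_) (+-identityʳ n)))
... | suc (suc _) | _  | s≤s (s≤s ())

m*2≡m+m : ∀ m → m * 2 ≡ m + m
m*2≡m+m m = trans (*-comm m 2) (cong (m +_) (+-identityʳ m))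

+-balanced : ∀ {m n o} → o ≤ m → o ≤ n → m + n ≡ o + o → m ≡ o
+-balanced {m} {n} {o} o≤m o≤n m+n≡o+o =
  ≤-antisym (+-cancelʳ-≤ n m o (subst (_≤ o + n) (sym m+n≡o+o) (+-monoʳ-≤ o o≤n))) o≤m

module _ {n : ℕ} {{_ : NonZero n}} where

  cw<n : (a x : Fin n) → cw a x < n
  cw<n a x = m%n<n _ n

  toℕ+[n∸toℕ]≡n : (a : Fin n) → toℕ a + (n ∸ toℕ a) ≡ n
  toℕ+[n∸toℕ]≡n a = m+[n∸m]≡n (<⇒≤ (toℕ<n a))

  cw-self : (a : Fin n) → cw a a ≡ 0
  cw-self a = trans (cong (_% n) (toℕ+[n∸toℕ]≡n a)) (n%n≡0 n)

  [toℕ+cw]%n≡toℕ : (a x : Fin n) → (toℕ a + cw a x) % n ≡ toℕ x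
  [toℕ+cw]%n≡toℕ a x = begin
    (toℕ a + cw a x) % n                  ≡⟨ [m+n%o]%o≡[m+n]%o (toℕ a) _ n ⟩
    (toℕ a + (toℕ x + (n ∸ toℕ a))) % n  ≡⟨ cong (_% n) (x∙yz≈y∙xz (toℕ a) (toℕ x) (n ∸ toℕ a)) ⟩
    (toℕ x + (toℕ a + (n ∸ toℕ a))) % n  ≡⟨ cong (λ t → (toℕ x + t) % n) (toℕ+[n∸toℕ]≡n a) ⟩
    (toℕ x + n) % n                       ≡⟨ [m+n]%n≡m%n (toℕ x) n ⟩
    toℕ x % n                             ≡⟨ m<n⇒m%n≡m (toℕ<n x) ⟩
    toℕ x                                 ∎
    where open ≡-Reasoning

  cw-injective : (a : Fin n) {x y : Fin n} → cw a x ≡ cw a y → x ≡ y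
  cw-injective a {x} {y} eq = toℕ-injective (begin
    toℕ x                 ≡⟨ [toℕ+cw]%n≡toℕ a x ⟨
    (toℕ a + cw a x) % n  ≡⟨ cong (λ t → (toℕ a + t) % n) eq ⟩
    (toℕ a + cw a y) % n  ≡⟨ [toℕ+cw]%n≡toℕ a y ⟩
    toℕ y                 ∎)
    where open ≡-Reasoning

  cw≡0⇒≡ : (a x : Fin n) → cw a x ≡ 0 → x ≡ a
  cw≡0⇒≡ a x eq = cw-injective a (trans eq (sym (cw-self a)))

  cw-compose : (a x y : Fin n) → (cw a x + cw x y) % n ≡ cw a y
  cw-compose a x y = begin
    (cw a x + cw x y) % n                               ≡⟨ %-distribˡ-+ _ _ n ⟨
    (toℕ x + (n ∸ toℕ a) + (toℕ y + (n ∸ toℕ x))) % n  ≡⟨ cong (_% n) (swap-summands (toℕ x) (n ∸ toℕ a) (toℕ y) (n ∸ toℕ x)) ⟩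
    (toℕ y + (n ∸ toℕ a) + (toℕ x + (n ∸ toℕ x))) % n  ≡⟨ cong (λ t → (toℕ y + (n ∸ toℕ a) + t) % n) (toℕ+[n∸toℕ]≡n x) ⟩
    (toℕ y + (n ∸ toℕ a) + n) % n                       ≡⟨ [m+n]%n≡m%n _ n ⟩
    cw a y                                              ∎
    where
      open ≡-Reasoning
      swap-summands : ∀ x a y b → x + a + (y + b) ≡ y + a + (x + b)
      swap-summands = solve 4 (λ x a y b → x :+ a :+ (y :+ b) := y :+ a :+ (x :+ b)) refl

  cw-triangle : (a x y : Fin n) → cw a x + cw x y ≡ cw a y ⊎ cw a x + cw x y ≡ cw a y + n
  cw-triangle a x y with m<n+n⇒m≡m%n⊎m≡m%n+n (cw a x + cw x y) n (+-mono-< (cw<n a x) (cw<n x y))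
  ... | inj₁ eq = inj₁ (trans eq (cw-compose a x y))
  ... | inj₂ eq = inj₂ (trans eq (cong (_+ n) (cw-compose a x y)))

  cw+cw≡n : {a b : Fin n} → a ≢ b → cw a b + cw b a ≡ n
  cw+cw≡n {a} {b} a≢b with cw-triangle a b a
  ... | inj₁ eq = ⊥-elim (a≢b (sym (cw≡0⇒≡ a b (m+n≡0⇒m≡0 (cw a b) (trans eq (cw-self a))))))
  ... | inj₂ eq = trans eq (cong (_+ n) (cw-self a))

  cw-next-% : (a x : Fin n) → cw a (next x) ≡ suc (cw a x) % n
  cw-next-% a x = begin
    cw a (next x)                        ≡⟨ cong (λ t → (t + (n ∸ toℕ a)) % n) (toℕ-fromℕ< (m%n<n (suc (toℕ x)) n)) ⟩
    (suc (toℕ x) % n + (n ∸ toℕ a)) % n  ≡⟨ [m%o+n]%o≡[m+n]%o (suc (toℕ x)) _ n ⟩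
    suc (toℕ x + (n ∸ toℕ a)) % n        ≡⟨ [m+n%o]%o≡[m+n]%o 1 _ n ⟨
    suc (cw a x) % n                     ∎
    where open ≡-Reasoning

  cw-next : (a x : Fin n) → next x ≢ a → cw a (next x) ≡ suc (cw a x)
  cw-next a x next≢a with suc (cw a x) <? n
  ... | yes lt = trans (cw-next-% a x) (m<n⇒m%n≡m lt)
  ... | no ≮n  = ⊥-elim (next≢a (cw≡0⇒≡ a (next x) (begin
    cw a (next x)     ≡⟨ cw-next-% a x ⟩
    suc (cw a x) % n  ≡⟨ cong (_% n) (≤-antisym (cw<n a x) (≮⇒≥ ≮n)) ⟩
    n % n             ≡⟨ n%n≡0 n ⟩
    0                 ∎)))
    where open ≡-Reasoning

  halving⇒cw≡half : {q : ℕ} → n ≡ q * 2 → {x y : Fin n} → Halving x y → cw x y ≡ q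
  halving⇒cw≡half {zero} n≡0 _ = ⊥-elim (≢-nonZero⁻¹ n n≡0)
  halving⇒cw≡half {suc r} n≡q*2 {x} {y} (x≢y , r≤cwxy∸1 , r≤cwyx∸1) =
    +-balanced (≤∸1⇒< (cw x y) (subst (_≤ cw x y ∸ 1) [n∸2]/2≡r r≤cwxy∸1) (x≢y ∘ sym ∘ cw≡0⇒≡ x y))
               (≤∸1⇒< (cw y x) (subst (_≤ cw y x ∸ 1) [n∸2]/2≡r r≤cwyx∸1) (x≢y ∘ cw≡0⇒≡ y x))
               (trans (cw+cw≡n x≢y) (trans n≡q*2 (m*2≡m+m (suc r))))
    where
      [n∸2]/2≡r : (n ∸ 2) / 2 ≡ r
      [n∸2]/2≡r = trans (cong (λ m → (m ∸ 2) / 2) n≡q*2) (m*n/n≡m r 2)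
      ≤∸1⇒< : ∀ u → r ≤ u ∸ 1 → u ≢ 0 → r < u
      ≤∸1⇒< zero    _ u≢0 = ⊥-elim (u≢0 refl)
      ≤∸1⇒< (suc u) r≤u _ = s≤s r≤u

  NonEndpoint : Fin n → Fin n → Fin n → Set
  NonEndpoint a b x = x ≢ a × x ≢ b

  antipodal-positions : {q : ℕ} → n ≡ q + q → {x y : Fin n} → cw x y ≡ q → (a : Fin n) →
    cw a x + q ≡ cw a y ⊎ cw a y + q ≡ cw a x
  antipodal-positions {q} n≡q+q {x} {y} cwxy≡q a with cw-triangle a x y
  ... | inj₁ eq = inj₁ (subst (λ t → cw a x + t ≡ cw a y) cwxy≡q eq)
  ... | inj₂ eq = inj₂ (+-cancelʳ-≡ q (cw a y + q) (cw a x) (begin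
    cw a y + q + q    ≡⟨ +-assoc (cw a y) q q ⟩
    cw a y + (q + q)  ≡⟨ cong (cw a y +_) n≡q+q ⟨
    cw a y + n        ≡⟨ eq ⟨
    cw a x + cw x y   ≡⟨ cong (cw a x +_) cwxy≡q ⟩
    cw a x + q        ∎))
    where open ≡-Reasoning

  antipodes-separated : {q : ℕ} → n ≡ q + q → {a b x y : Fin n} → suc (cw a b) ≡ q →
    cw a x + q ≡ cw a y → NonEndpoint a b x → Between a b x × ¬ Between a b y
  antipodes-separated {q} n≡q+q {a} {b} {x} {y} 1+cwab≡q cwax+q≡cway (x≢a , x≢b) =
    (n≢0⇒n>0 (x≢a ∘ cw≡0⇒≡ a x) , cwax<cwab) , λ (_ , cway<cwab) → <⇒≱ cway<cwab cwab≤cway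
    where
      cwab≤cway : cw a b ≤ cw a y
      cwab≤cway = ≤-trans (≤-trans (n≤1+n (cw a b)) (≤-reflexive 1+cwab≡q))
                          (subst (q ≤_) cwax+q≡cway (m≤n+m q (cw a x)))
      cwax<q : cw a x < q
      cwax<q = +-cancelʳ-< q (cw a x) q (subst (_< q + q) (sym cwax+q≡cway) (subst (cw a y <_) n≡q+q (cw<n a y)))
      cwax<cwab : cw a x < cw a b
      cwax<cwab = ≤∧≢⇒< (s≤s⁻¹ (subst (cw a x <_) (sym 1+cwab≡q) cwax<q)) (x≢b ∘ cw-injective a)

  antipodes-cross : {q : ℕ} → n ≡ q + q → {a b x y : Fin n} → suc (cw a b) ≡ q → cw x y ≡ q →
    NonEndpoint a b x → NonEndpoint a b y → Cross a b x y
  antipodes-cross n≡q+q {a} 1+cwab≡q cwxy≡q x∉ab y∉ab with antipodal-positions n≡q+q cwxy≡q a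
  ... | inj₁ eq = inj₁ (antipodes-separated n≡q+q 1+cwab≡q eq x∉ab)
  ... | inj₂ eq = inj₂ (swap (antipodes-separated n≡q+q 1+cwab≡q eq y∉ab))

  Between-dichotomy : {a b x : Fin n} → a ≢ b → NonEndpoint a b x →
    (Between a b x × ¬ Between b a x) ⊎ (¬ Between a b x × Between b a x)
  Between-dichotomy {a} {b} {x} a≢b (x≢a , x≢b) with cw-triangle a b x
  ... | inj₁ eq = inj₂ ((λ (_ , cwax<cwab) → <⇒≱ cwax<cwab (subst (cw a b ≤_) eq (m≤m+n (cw a b) (cw b x))))
                       , (n≢0⇒n>0 (x≢b ∘ cw≡0⇒≡ b x) , +-cancelˡ-< (cw a b) (cw b x) (cw b a)
                                     (subst₂ _<_ (sym eq) (sym (cw+cw≡n a≢b)) (cw<n a x))))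
  ... | inj₂ eq = inj₁ ((n≢0⇒n>0 (x≢a ∘ cw≡0⇒≡ a x)
                        , +-cancelʳ-< n (cw a x) (cw a b) (subst (_< cw a b + n) eq (+-monoʳ-< (cw a b) (cw<n b x))))
                       , λ (_ , cwbx<cwba) → <-irrefl refl (begin-strict
                           cw a b + cw b x  <⟨ +-monoʳ-< (cw a b) cwbx<cwba ⟩
                           cw a b + cw b a  ≡⟨ cw+cw≡n a≢b ⟩
                           n                ≤⟨ m≤n+m n (cw a x) ⟩
                           cw a x + n       ≡⟨ eq ⟨
                           cw a b + cw b x  ∎))
    where open ≤-Reasoning

  Between-swap⇒¬Between : {a b z : Fin n} → a ≢ b → NonEndpoint a b z → Between b a z → ¬ Between a b z
  Between-swap⇒¬Between a≢b z∉ab z-in-ba with Between-dichotomy a≢b z∉ab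
  ... | inj₁ (_ , z-out-ba) = ⊥-elim (z-out-ba z-in-ba)
  ... | inj₂ (z-out-ab , _) = z-out-ab

  ¬Between-swap⇒Between : {a b z : Fin n} → a ≢ b → NonEndpoint a b z → ¬ Between b a z → Between a b z
  ¬Between-swap⇒Between a≢b z∉ab z-out-ba with Between-dichotomy a≢b z∉ab
  ... | inj₁ (z-in-ab , _) = z-in-ab
  ... | inj₂ (_ , z-in-ba) = ⊥-elim (z-out-ba z-in-ba)

  Cross-swap : {a b x y : Fin n} → a ≢ b → NonEndpoint a b x → NonEndpoint a b y → Cross b a x y → Cross a b x y
  Cross-swap a≢b x∉ab y∉ab (inj₁ (x-in , y-out)) =
    inj₂ (Between-swap⇒¬Between a≢b x∉ab x-in , ¬Between-swap⇒Between a≢b y∉ab y-out)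
  Cross-swap a≢b x∉ab y∉ab (inj₂ (x-out , y-in)) =
    inj₁ (¬Between-swap⇒Between a≢b x∉ab x-out , Between-swap⇒¬Between a≢b y∉ab y-in)

  Between? : (a b x : Fin n) → Dec (Between a b x)
  Between? a b x = (0 <? cw a x) ×-dec (cw a x <? cw a b)

  Cross? : (a b c d : Fin n) → Dec (Cross a b c d)
  Cross? a b c d = (Between? a b c ×-dec ¬? (Between? a b d)) ⊎-dec (¬? (Between? a b c) ×-dec Between? a b d)

  Intersect? : (a b c d : Fin n) → Dec (Intersect a b c d)
  Intersect? a b c d = a ≟ᶠ c ⊎-dec a ≟ᶠ d ⊎-dec b ≟ᶠ c ⊎-dec b ≟ᶠ d ⊎-dec Cross? a b c d

  SameSide : Fin n → Fin n → Fin n → Fin n → Set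
  SameSide a b x y = NonEndpoint a b x × NonEndpoint a b y × (Between a b x ⇔ Between a b y)

  SameSide-trans : {a b x y z : Fin n} → SameSide a b x y → SameSide a b y z → SameSide a b x z
  SameSide-trans (x∉ab , _ , x⇔y) (_ , z∉ab , y⇔z) = x∉ab , z∉ab , ⇔.trans x⇔y y⇔z

  SameSide⇒¬Intersect : {a b x y : Fin n} → SameSide a b x y → ¬ Intersect a b x y
  SameSide⇒¬Intersect ((x≢a , _) , _) (inj₁ a≡x) = x≢a (sym a≡x)
  SameSide⇒¬Intersect (_ , (y≢a , _) , _) (inj₂ (inj₁ a≡y)) = y≢a (sym a≡y)
  SameSide⇒¬Intersect ((_ , x≢b) , _) (inj₂ (inj₂ (inj₁ b≡x))) = x≢b (sym b≡x)
  SameSide⇒¬Intersect (_ , (_ , y≢b) , _) (inj₂ (inj₂ (inj₂ (inj₁ b≡y)))) = y≢b (sym b≡y)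
  SameSide⇒¬Intersect (_ , _ , x⇔y) (inj₂ (inj₂ (inj₂ (inj₂ (inj₁ (x-in , y-out)))))) = y-out (Equivalence.to x⇔y x-in)
  SameSide⇒¬Intersect (_ , _ , x⇔y) (inj₂ (inj₂ (inj₂ (inj₂ (inj₂ (x-out , y-in)))))) = x-out (Equivalence.from x⇔y y-in)

  ¬Intersect⇒SameSide : {a b x y : Fin n} → ¬ Intersect a b x y → SameSide a b x y
  ¬Intersect⇒SameSide {a} {b} {x} {y} ¬meet =
    (¬meet ∘ inj₁ ∘ sym , ¬meet ∘ inj₂ ∘ inj₂ ∘ inj₁ ∘ sym) ,
    (¬meet ∘ inj₂ ∘ inj₁ ∘ sym , ¬meet ∘ inj₂ ∘ inj₂ ∘ inj₂ ∘ inj₁ ∘ sym) ,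
    mk⇔ (λ x-in → decidable-stable (Between? a b y) (λ y-out → ¬cross (inj₁ (x-in , y-out))))
        (λ y-in → decidable-stable (Between? a b x) (λ x-out → ¬cross (inj₂ (x-out , y-in))))
    where
      ¬cross : ¬ Cross a b x y
      ¬cross = ¬meet ∘ inj₂ ∘ inj₂ ∘ inj₂ ∘ inj₂

  next-SameSide : {a b x : Fin n} → NonEndpoint a b x → NonEndpoint a b (next x) → SameSide a b x (next x)
  next-SameSide {a} {b} {x} x∉ab@(x≢a , _) next∉ab@(next≢a , next≢b) = x∉ab , next∉ab , mk⇔ forward backward
    where
      cw-next-x : cw a (next x) ≡ suc (cw a x)
      cw-next-x = cw-next a x next≢a
      forward : Between a b x → Between a b (next x)
      forward (_ , cwax<cwab) =
        subst (0 <_) (sym cw-next-x) z<s ,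
        subst (_< cw a b) (sym cw-next-x) (≤∧≢⇒< cwax<cwab (next≢b ∘ cw-injective a ∘ trans cw-next-x))
      backward : Between a b (next x) → Between a b x
      backward (_ , cw-next<cwab) =
        n≢0⇒n>0 (x≢a ∘ cw≡0⇒≡ a x) , <-trans (n<1+n (cw a x)) (subst (_< cw a b) cw-next-x cw-next<cwab)

  intersect-if-crossing : {a b c d : Fin n} → (NonEndpoint a b c → NonEndpoint a b d → Cross a b c d) → Intersect a b c d
  intersect-if-crossing {a} {b} {c} {d} crossing with Intersect? a b c d
  ... | yes meet = meet
  ... | no ¬meet with ¬Intersect⇒SameSide ¬meet
  ...   | c∉ab , d∉ab , _ = ⊥-elim (¬meet (inj₂ (inj₂ (inj₂ (inj₂ (crossing c∉ab d∉ab))))))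

  almostHalving-meets-halving : {q : ℕ} → n ≡ q * 2 → {a b c d : Fin n} →
    AlmostHalving a b → Halving c d → Intersect a b c d
  almostHalving-meets-halving {q} n≡q*2 {a} {b} {c} {d} (a≢b , h) hcd = intersect-if-crossing (crosses h)
    where
      n≡q+q : n ≡ q + q
      n≡q+q = trans n≡q*2 (m*2≡m+m q)
      suc-cw≡half : {x y : Fin n} → Halving x (next y) → suc (cw x y) ≡ q
      suc-cw≡half {x} {y} hxy@(x≢next , _) = trans (sym (cw-next x y (x≢next ∘ sym))) (halving⇒cw≡half n≡q*2 hxy)
      crosses : Halving a (next b) ⊎ Halving b (next a) → NonEndpoint a b c → NonEndpoint a b d → Cross a b c d
      crosses (inj₁ h) c∉ab d∉ab = antipodes-cross n≡q+q (suc-cw≡half h) (halving⇒cw≡half n≡q*2 hcd) c∉ab d∉ab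
      crosses (inj₂ h) c∉ab d∉ab = Cross-swap a≢b c∉ab d∉ab
        (antipodes-cross n≡q+q (suc-cw≡half h) (halving⇒cw≡half n≡q*2 hcd) (swap c∉ab) (swap d∉ab))

  meets-halvingPair : {a b : Fin n} → ((c d : Fin n) → Halving c d → Intersect a b c d) →
    (i j k : Fin n) → HalvingPair i j k → Intersect a b i j ⊎ Intersect a b (next j) k
  meets-halvingPair {a} {b} meets i j k (_ , _ , _ , halving) with Intersect? a b i j | Intersect? a b (next j) k
  ... | yes meet | _ = inj₁ meet
  ... | no _ | yes meet = inj₂ meet
  ... | no ¬meet | no ¬meet′ with ¬Intersect⇒SameSide ¬meet | ¬Intersect⇒SameSide ¬meet′
  ...   | i~j@(_ , j∉ab , _) | j′~k@(j′∉ab , _ , _) = ⊥-elim (one-side halving)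
    where
      j~j′ : SameSide a b j (next j)
      j~j′ = next-SameSide j∉ab j′∉ab
      one-side : Halving i (next j) ⊎ Halving i k ⊎ Halving j k → ⊥
      one-side (inj₁ h) = SameSide⇒¬Intersect (SameSide-trans i~j j~j′) (meets i (next j) h)
      one-side (inj₂ (inj₁ h)) = SameSide⇒¬Intersect (SameSide-trans i~j (SameSide-trans j~j′ j′~k)) (meets i k h)
      one-side (inj₂ (inj₂ h)) = SameSide⇒¬Intersect (SameSide-trans j~j′ j′~k) (meets j k h)

lemma2 : (n : ℕ) {{_ : NonZero n}} → 2 ∣ n →
    (a b : Fin n) → AlmostHalving a b →
    ((c d : Fin n) → Halving c d → Intersect a b c d) ×
    ((i j k : Fin n) → HalvingPair i j k →
      Intersect a b i j ⊎ Intersect a b (next j) k)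
lemma2 n (divides q n≡q*2) a b almost = meets , meets-halvingPair meets
  where
    meets : (c d : Fin n) → Halving c d → Intersect a b c d
    meets c d = almostHalving-meets-halving {q = q} n≡q*2 almost
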